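{- Let $\mathcal{V}$ be a cartesian closed category, $(T,\delta,\epsilon)$ a comonad on $\mathcal{V}$ preserving finite products, and $\alpha:\mathrm{Id}\Rightarrow T$ a natural transformation such that each $\alpha_X:X\to TX$ is a $T$-coalgebra. Then $F:\mathcal{V}_T\to\mathcal{V}$ defined by $F(X)=X$ and $F(f)=f\circ\alpha_X:X\to Y$ for a co-Kleisli morphism $f:TX\to Y$ is a normal cartesian functor.
   Context: The co-Kleisli category $\mathcal{V}_T$ has morphisms $X\to Y$ the morphisms $TX\to Y$ of $\mathcal{V}$, composition $g\circ_T f=g\circ Tf\circ\delta$, and finite products those of $\mathcal{V}$. $\alpha_X$ is a $T$-coalgebra if $\epsilon_X\circ\alpha_X=\mathrm{id}_X$ and $\delta_X\circ\alpha_X=T\alpha_X\circ\alpha_X$. A cartesian functor preserves finite products. A finite-product-preserving functor $F$ between cartesian categories is normal if for each $X$ the map $\mathrm{Hom}(1,X)\to\mathrm{Hom}(1,FX)$, $f\mapsto Ff\circ\iota$ with $\iota:1\to F1$ the canonical map, is a bijection. -}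

module Defs where

open import Level using (Level; _⊔_) renaming (suc to lsuc)
open import Data.Product using (Σ)
open import Relation.Binary using (Rel; IsEquivalence; Setoid)
import Relation.Binary.Reasoning.Setoid as SetoidR

record Category (o ℓ e : Level) : Set (lsuc (o ⊔ ℓ ⊔ e)) where
  infix  4 _≈_ _⇒_
  infixr 9 _∘_
  field
    Obj  : Set o
    _⇒_  : Obj → Obj → Set ℓ
    _≈_  : ∀ {A B} → Rel (A ⇒ B) e
    id   : ∀ {A} → A ⇒ A
    _∘_  : ∀ {A B C} → B ⇒ C → A ⇒ B → A ⇒ C
    equiv     : ∀ {A B} → IsEquivalence (_≈_ {A} {B})
    assoc     : ∀ {A B C D} {f : A ⇒ B} {g : B ⇒ C} {h : C ⇒ D} →
                (h ∘ g) ∘ f ≈ h ∘ (g ∘ f)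
    identityˡ : ∀ {A B} {f : A ⇒ B} → id ∘ f ≈ f
    identityʳ : ∀ {A B} {f : A ⇒ B} → f ∘ id ≈ f
    ∘-resp-≈  : ∀ {A B C} {f h : B ⇒ C} {g i : A ⇒ B} →
                f ≈ h → g ≈ i → f ∘ g ≈ h ∘ i

  hom-setoid : ∀ {A B} → Setoid ℓ e
  hom-setoid {A} {B} = record { Carrier = A ⇒ B ; _≈_ = _≈_ ; isEquivalence = equiv }

  module Equiv {A B : Obj} = IsEquivalence (equiv {A} {B})

record IsIso {o ℓ e} (C : Category o ℓ e) {A B : Category.Obj C}
             (f : Category._⇒_ C A B) : Set (ℓ ⊔ e) where
  open Category C
  field
    inv  : B ⇒ A
    isoˡ : inv ∘ f ≈ id
    isoʳ : f ∘ inv ≈ id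

record Cartesian {o ℓ e} (C : Category o ℓ e) : Set (o ⊔ ℓ ⊔ e) where
  open Category C
  infixr 7 _×_
  field
    ⊤        : Obj
    !        : ∀ {A} → A ⇒ ⊤
    !-unique : ∀ {A} (f : A ⇒ ⊤) → ! ≈ f
    _×_      : Obj → Obj → Obj
    π₁       : ∀ {A B} → A × B ⇒ A
    π₂       : ∀ {A B} → A × B ⇒ B
    ⟨_,_⟩    : ∀ {X A B} → X ⇒ A → X ⇒ B → X ⇒ A × B
    project₁ : ∀ {X A B} {f : X ⇒ A} {g : X ⇒ B} → π₁ ∘ ⟨ f , g ⟩ ≈ f
    project₂ : ∀ {X A B} {f : X ⇒ A} {g : X ⇒ B} → π₂ ∘ ⟨ f , g ⟩ ≈ g
    unique   : ∀ {X A B} {f : X ⇒ A} {g : X ⇒ B} {h : X ⇒ A × B} →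
               π₁ ∘ h ≈ f → π₂ ∘ h ≈ g → ⟨ f , g ⟩ ≈ h

  _⁂_ : ∀ {A B C D} → A ⇒ B → C ⇒ D → A × C ⇒ B × D
  f ⁂ g = ⟨ f ∘ π₁ , g ∘ π₂ ⟩

record CartesianCategory (o ℓ e : Level) : Set (lsuc (o ⊔ ℓ ⊔ e)) where
  field
    U         : Category o ℓ e
    cartesian : Cartesian U
  open Category U public
  open Cartesian cartesian public

record Closed {o ℓ e} (V : CartesianCategory o ℓ e) : Set (o ⊔ ℓ ⊔ e) where
  open CartesianCategory V
  infixr 8 _^_
  field
    _^_       : Obj → Obj → Obj
    eval      : ∀ {A B} → (B ^ A) × A ⇒ B
    λg        : ∀ {X A B} → X × A ⇒ B → X ⇒ B ^ A
    β         : ∀ {X A B} {f : X × A ⇒ B} → eval ∘ (λg f ⁂ id) ≈ f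
    λ-unique  : ∀ {X A B} {f : X × A ⇒ B} {h : X ⇒ B ^ A} →
                eval ∘ (h ⁂ id) ≈ f → h ≈ λg f

record IsFunctor {o ℓ e o′ ℓ′ e′} (C : Category o ℓ e) (D : Category o′ ℓ′ e′)
                 (F₀ : Category.Obj C → Category.Obj D)
                 (F₁ : ∀ {A B} → Category._⇒_ C A B → Category._⇒_ D (F₀ A) (F₀ B))
                 : Set (o ⊔ ℓ ⊔ e ⊔ e′) where
  private
    module C = Category C
    module D = Category D
  field
    identity     : ∀ {A} → F₁ (C.id {A}) D.≈ D.id
    homomorphism : ∀ {X Y Z} {f : X C.⇒ Y} {g : Y C.⇒ Z} →
                   F₁ (g C.∘ f) D.≈ F₁ g D.∘ F₁ f
    F-resp-≈     : ∀ {A B} {f g : A C.⇒ B} → f C.≈ g → F₁ f D.≈ F₁ g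

record Functor {o ℓ e o′ ℓ′ e′} (C : Category o ℓ e) (D : Category o′ ℓ′ e′)
               : Set (o ⊔ ℓ ⊔ e ⊔ o′ ⊔ ℓ′ ⊔ e′) where
  field
    F₀ : Category.Obj C → Category.Obj D
    F₁ : ∀ {A B} → Category._⇒_ C A B → Category._⇒_ D (F₀ A) (F₀ B)
    isFunctor : IsFunctor C D F₀ F₁
  open IsFunctor isFunctor public

record Comonad {o ℓ e} (C : Category o ℓ e) : Set (o ⊔ ℓ ⊔ e) where
  open Category C
  field
    T : Functor C C
  open Functor T public renaming (F₀ to T₀; F₁ to T₁)
  field
    ε : ∀ X → T₀ X ⇒ X
    δ : ∀ X → T₀ X ⇒ T₀ (T₀ X)
    ε-natural : ∀ {X Y} (f : X ⇒ Y) → ε Y ∘ T₁ f ≈ f ∘ ε X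
    δ-natural : ∀ {X Y} (f : X ⇒ Y) → δ Y ∘ T₁ f ≈ T₁ (T₁ f) ∘ δ X
    identityˡ-law : ∀ {X} → ε (T₀ X) ∘ δ X ≈ id
    identityʳ-law : ∀ {X} → T₁ (ε X) ∘ δ X ≈ id
    assoc-law     : ∀ {X} → δ (T₀ X) ∘ δ X ≈ T₁ (δ X) ∘ δ X

record IsCoalgebra {o ℓ e} {C : Category o ℓ e} (M : Comonad C) {X : Category.Obj C}
                   (α : Category._⇒_ C X (Comonad.T₀ M X)) : Set e where
  open Category C
  open Comonad M
  field
    counit : ε X ∘ α ≈ id
    coassoc : δ X ∘ α ≈ T₁ α ∘ α

module _ {o ℓ e} {C : Category o ℓ e} (M : Comonad C) where
  open Category C
  open Comonad M
  open Equiv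

  private
    lemε : ∀ {X A} (h : T₀ X ⇒ A) → ε A ∘ (T₁ h ∘ δ X) ≈ h
    lemε {X} {A} h = begin
        ε A ∘ (T₁ h ∘ δ X)   ≈⟨ sym assoc ⟩
        (ε A ∘ T₁ h) ∘ δ X   ≈⟨ ∘-resp-≈ (ε-natural h) refl ⟩
        (h ∘ ε (T₀ X)) ∘ δ X ≈⟨ assoc ⟩
        h ∘ (ε (T₀ X) ∘ δ X) ≈⟨ ∘-resp-≈ refl identityˡ-law ⟩
        h ∘ id               ≈⟨ identityʳ ⟩
        h ∎
      where open SetoidR hom-setoid

  CoKleisli : Category o ℓ e
  CoKleisli = record
    { Obj = Obj
    ; _⇒_ = λ X Y → T₀ X ⇒ Y
    ; _≈_ = _≈_
    ; id = λ {A} → ε A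
    ; _∘_ = λ {A} g f → g ∘ (T₁ f ∘ δ A)
    ; equiv = equiv
    ; assoc = λ {A} {B} {C} {D} {f} {g} {h} →
        let open SetoidR hom-setoid in begin
        (h ∘ (T₁ g ∘ δ B)) ∘ (T₁ f ∘ δ A)     ≈⟨ assoc ⟩
        h ∘ ((T₁ g ∘ δ B) ∘ (T₁ f ∘ δ A))     ≈⟨ ∘-resp-≈ refl assoc ⟩
        h ∘ (T₁ g ∘ (δ B ∘ (T₁ f ∘ δ A)))     ≈⟨ ∘-resp-≈ refl (∘-resp-≈ refl (sym assoc)) ⟩
        h ∘ (T₁ g ∘ ((δ B ∘ T₁ f) ∘ δ A))     ≈⟨ ∘-resp-≈ refl (∘-resp-≈ refl (∘-resp-≈ (δ-natural f) refl)) ⟩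
        h ∘ (T₁ g ∘ ((T₁ (T₁ f) ∘ δ (T₀ A)) ∘ δ A)) ≈⟨ ∘-resp-≈ refl (∘-resp-≈ refl assoc) ⟩
        h ∘ (T₁ g ∘ (T₁ (T₁ f) ∘ (δ (T₀ A) ∘ δ A))) ≈⟨ ∘-resp-≈ refl (∘-resp-≈ refl (∘-resp-≈ refl assoc-law)) ⟩
        h ∘ (T₁ g ∘ (T₁ (T₁ f) ∘ (T₁ (δ A) ∘ δ A))) ≈⟨ ∘-resp-≈ refl (∘-resp-≈ refl (sym assoc)) ⟩
        h ∘ (T₁ g ∘ ((T₁ (T₁ f) ∘ T₁ (δ A)) ∘ δ A)) ≈⟨ ∘-resp-≈ refl (sym assoc) ⟩
        h ∘ ((T₁ g ∘ (T₁ (T₁ f) ∘ T₁ (δ A))) ∘ δ A) ≈⟨ ∘-resp-≈ refl (∘-resp-≈ (∘-resp-≈ refl (sym homomorphism)) refl) ⟩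
        h ∘ ((T₁ g ∘ T₁ (T₁ f ∘ δ A)) ∘ δ A)  ≈⟨ ∘-resp-≈ refl (∘-resp-≈ (sym homomorphism) refl) ⟩
        h ∘ (T₁ (g ∘ (T₁ f ∘ δ A)) ∘ δ A) ∎
    ; identityˡ = λ {A} {B} {f} → lemε f
    ; identityʳ = λ {A} {B} {f} →
        let open SetoidR hom-setoid in begin
        f ∘ (T₁ (ε A) ∘ δ A) ≈⟨ ∘-resp-≈ refl identityʳ-law ⟩
        f ∘ id               ≈⟨ identityʳ ⟩
        f ∎
    ; ∘-resp-≈ = λ p q → ∘-resp-≈ p (∘-resp-≈ (F-resp-≈ q) refl)
    }

module _ {o ℓ e} (V : CartesianCategory o ℓ e)
         (M : Comonad (CartesianCategory.U V)) where
  open CartesianCategory V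
  open Comonad M
  open Equiv

  private
    lemπ : ∀ {X A B} (p : A ⇒ B) (h : T₀ X ⇒ A) →
           (p ∘ ε A) ∘ (T₁ h ∘ δ X) ≈ p ∘ h
    lemπ {X} {A} p h = begin
        (p ∘ ε A) ∘ (T₁ h ∘ δ X) ≈⟨ assoc ⟩
        p ∘ (ε A ∘ (T₁ h ∘ δ X)) ≈⟨ ∘-resp-≈ refl (Category.identityˡ (CoKleisli M) {f = h}) ⟩
        p ∘ h ∎
      where open SetoidR hom-setoid

  CoKleisliCartesian : CartesianCategory o ℓ e
  CoKleisliCartesian = record
    { U = CoKleisli M
    ; cartesian = record
      { ⊤ = ⊤
      ; ! = !
      ; !-unique = !-unique
      ; _×_ = _×_
      ; π₁ = λ {A} {B} → π₁ ∘ ε (A × B)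
      ; π₂ = λ {A} {B} → π₂ ∘ ε (A × B)
      ; ⟨_,_⟩ = ⟨_,_⟩
      ; project₁ = λ {X} {A} {B} {f} {g} → trans (lemπ π₁ ⟨ f , g ⟩) project₁
      ; project₂ = λ {X} {A} {B} {f} {g} → trans (lemπ π₂ ⟨ f , g ⟩) project₂
      ; unique = λ {X} {A} {B} {f} {g} {h} p q →
          unique (trans (sym (lemπ π₁ h)) p) (trans (sym (lemπ π₂ h)) q)
      }
    }

record PreservesFiniteProducts {o ℓ e o′ ℓ′ e′}
       (C : CartesianCategory o ℓ e) (D : CartesianCategory o′ ℓ′ e′)
       (F₀ : CartesianCategory.Obj C → CartesianCategory.Obj D)
       (F₁ : ∀ {A B} → CartesianCategory._⇒_ C A B →
                       CartesianCategory._⇒_ D (F₀ A) (F₀ B))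
       : Set (o ⊔ ℓ′ ⊔ e′) where
  private
    module C = CartesianCategory C
    module D = CartesianCategory D
  field
    terminal : IsIso D.U (D.! {F₀ C.⊤})
    products : ∀ X Y → IsIso D.U (D.⟨ F₁ (C.π₁ {X} {Y}) , F₁ (C.π₂ {X} {Y}) ⟩)

  ι : D.⊤ D.⇒ F₀ C.⊤
  ι = IsIso.inv terminal

record IsNormal {o ℓ e o′ ℓ′ e′}
       (C : CartesianCategory o ℓ e) (D : CartesianCategory o′ ℓ′ e′)
       (F₀ : CartesianCategory.Obj C → CartesianCategory.Obj D)
       (F₁ : ∀ {A B} → CartesianCategory._⇒_ C A B →
                       CartesianCategory._⇒_ D (F₀ A) (F₀ B))
       (P : PreservesFiniteProducts C D F₀ F₁)
       : Set (o ⊔ ℓ ⊔ e ⊔ ℓ′ ⊔ e′) where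
  private
    module C = CartesianCategory C
    module D = CartesianCategory D
  open PreservesFiniteProducts P using (ι)

  φ : ∀ {X} → C.⊤ C.⇒ X → D.⊤ D.⇒ F₀ X
  φ f = F₁ f D.∘ ι

  field
    injective  : ∀ {X} {f g : C.⊤ C.⇒ X} → φ f D.≈ φ g → f C.≈ g
    surjective : ∀ {X} (h : D.⊤ D.⇒ F₀ X) → Σ (C.⊤ C.⇒ X) (λ f → φ f D.≈ h)

module _ {o ℓ e} {C : Category o ℓ e} (M : Comonad C) where
  open Category C
  open Comonad M

  coKleisliF₀ : Obj → Obj
  coKleisliF₀ X = X

  coKleisliF₁ : (α : ∀ X → X ⇒ T₀ X) → ∀ {X Y} → T₀ X ⇒ Y → X ⇒ Y
  coKleisliF₁ α {X} f = f ∘ α X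

-- The coalgebra laws of α are exactly the functor laws of F: the counit law gives
-- F ε = id, and coassociativity together with naturality of α turns
-- (g ∘ T f ∘ δ) ∘ α into (g ∘ α) ∘ (f ∘ α). Since F is the identity on objects and
-- sends the co-Kleisli projections π ∘ ε to π, the comparison maps for products are
-- identities. Finally T ⊤ is terminal, so α ⊤ is an isomorphism and normality is
-- just bijectivity of precomposition with an isomorphism.
module Submission where

open import Defs
open import Data.Product using (Σ; _×_; _,_)
import Relation.Binary.Reasoning.Setoid as SetoidR

module _ {o ℓ e} (C : Category o ℓ e) where
  open Category C
  open Equiv

  ≈id⇒isIso : ∀ {A} {f : A ⇒ A} → f ≈ id → IsIso C f
  ≈id⇒isIso f≈id = record
    { inv  = id
    ; isoˡ = trans identityˡ f≈id
    ; isoʳ = trans identityʳ f≈id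
    }

  module _ {A B} {i : A ⇒ B} (iso : IsIso C i) where
    open IsIso iso

    ∘-isoʳ-cancel : ∀ {X} {f g : B ⇒ X} → f ∘ i ≈ g ∘ i → f ≈ g
    ∘-isoʳ-cancel {f = f} {g} fi≈gi = begin
      f                 ≈⟨ cancel f ⟨
      (f ∘ i) ∘ inv     ≈⟨ ∘-resp-≈ fi≈gi refl ⟩
      (g ∘ i) ∘ inv     ≈⟨ cancel g ⟩
      g                 ∎
      where
      open SetoidR hom-setoid
      cancel : ∀ {X} (h : B ⇒ X) → (h ∘ i) ∘ inv ≈ h
      cancel h = trans assoc (trans (∘-resp-≈ refl isoʳ) identityʳ)

    ∘-isoʳ-section : ∀ {X} (h : A ⇒ X) → (h ∘ inv) ∘ i ≈ h
    ∘-isoʳ-section h = trans assoc (trans (∘-resp-≈ refl isoˡ) identityʳ)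

module _ {o ℓ e} (V : CartesianCategory o ℓ e) where
  open CartesianCategory V renaming (_×_ to _×ᵒ_)
  open Equiv

  !-unique₂ : ∀ {A} (u v : A ⇒ ⊤) → u ≈ v
  !-unique₂ u v = trans (sym (!-unique u)) (!-unique v)

  ⟨π₁,π₂⟩≈id : ∀ {A B} {p : A ×ᵒ B ⇒ A} {q : A ×ᵒ B ⇒ B} →
               p ≈ π₁ → q ≈ π₂ → ⟨ p , q ⟩ ≈ id
  ⟨π₁,π₂⟩≈id p≈π₁ q≈π₂ = unique (trans identityʳ (sym p≈π₁)) (trans identityʳ (sym q≈π₂))

  module _ {A} (!-iso : IsIso U (! {A})) where
    open IsIso !-iso

    terminal-≅-unique : ∀ {X} (u v : X ⇒ A) → u ≈ v
    terminal-≅-unique u v = begin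
      u               ≈⟨ identityˡ ⟨
      id ∘ u          ≈⟨ ∘-resp-≈ isoˡ refl ⟨
      (inv ∘ !) ∘ u   ≈⟨ assoc ⟩
      inv ∘ (! ∘ u)   ≈⟨ ∘-resp-≈ refl (!-unique₂ _ _) ⟩
      inv ∘ (! ∘ v)   ≈⟨ assoc ⟨
      (inv ∘ !) ∘ v   ≈⟨ ∘-resp-≈ isoˡ refl ⟩
      id ∘ v          ≈⟨ identityˡ ⟩
      v               ∎
      where open SetoidR hom-setoid

    point-of-terminal-isIso : (u : ⊤ ⇒ A) → IsIso U u
    point-of-terminal-isIso u = record
      { inv  = !
      ; isoˡ = !-unique₂ _ _
      ; isoʳ = terminal-≅-unique _ _
      }

module _ {o ℓ e} {C : Category o ℓ e} (M : Comonad C) where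
  open Category C
  open Comonad M using (T₀; T₁; ε; δ)
  open Equiv

module _ {o ℓ e} {C : Category o ℓ e} (M : Comonad C)
         (α : ∀ X → Category._⇒_ C X (Comonad.T₀ M X))
         (α-natural : ∀ {X Y} (f : Category._⇒_ C X Y) →
                      Category._≈_ C (Category._∘_ C (α Y) f)
                                     (Category._∘_ C (Comonad.T₁ M f) (α X)))
         (α-coalgebra : ∀ X → IsCoalgebra M (α X)) where
  open Category C
  open Comonad M using (T₀; T₁; ε; δ)
  open Equiv
  module α X = IsCoalgebra (α-coalgebra X)

  coKleisliF-homomorphism : ∀ {X Y Z} {f : T₀ X ⇒ Y} {g : T₀ Y ⇒ Z} →
                            (g ∘ (T₁ f ∘ δ X)) ∘ α X ≈ (g ∘ α Y) ∘ (f ∘ α X)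
  coKleisliF-homomorphism {X} {Y} {f = f} {g} = begin
    (g ∘ (T₁ f ∘ δ X)) ∘ α X        ≈⟨ assoc ⟩
    g ∘ ((T₁ f ∘ δ X) ∘ α X)        ≈⟨ ∘-resp-≈ refl assoc ⟩
    g ∘ (T₁ f ∘ (δ X ∘ α X))        ≈⟨ ∘-resp-≈ refl (∘-resp-≈ refl (α.coassoc X)) ⟩
    g ∘ (T₁ f ∘ (T₁ (α X) ∘ α X))   ≈⟨ ∘-resp-≈ refl (∘-resp-≈ refl (α-natural (α X))) ⟨
    g ∘ (T₁ f ∘ (α (T₀ X) ∘ α X))   ≈⟨ ∘-resp-≈ refl assoc ⟨
    g ∘ ((T₁ f ∘ α (T₀ X)) ∘ α X)   ≈⟨ ∘-resp-≈ refl (∘-resp-≈ (α-natural f) refl) ⟨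
    g ∘ ((α Y ∘ f) ∘ α X)           ≈⟨ ∘-resp-≈ refl assoc ⟩
    g ∘ (α Y ∘ (f ∘ α X))           ≈⟨ assoc ⟨
    (g ∘ α Y) ∘ (f ∘ α X)           ∎
    where open SetoidR hom-setoid

  coKleisliF-isFunctor : IsFunctor (CoKleisli M) C (coKleisliF₀ M) (coKleisliF₁ M α)
  coKleisliF-isFunctor = record
    { identity     = λ {A} → α.counit A
    ; homomorphism = coKleisliF-homomorphism
    ; F-resp-≈     = λ f≈g → ∘-resp-≈ f≈g refl
    }

  coKleisliF-ε : ∀ {A B} (p : A ⇒ B) → coKleisliF₁ M α (p ∘ ε A) ≈ p
  coKleisliF-ε {A} p = trans assoc (trans (∘-resp-≈ refl (α.counit A)) identityʳ)

module _ {o ℓ e} (V : CartesianCategory o ℓ e) (M : Comonad (CartesianCategory.U V))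
         (T-preserves-products : PreservesFiniteProducts V V (Comonad.T₀ M) (Comonad.T₁ M))
         (α : ∀ X → CartesianCategory._⇒_ V X (Comonad.T₀ M X))
         (α-natural : ∀ {X Y} (f : CartesianCategory._⇒_ V X Y) →
                      CartesianCategory._≈_ V (CartesianCategory._∘_ V (α Y) f)
                                              (CartesianCategory._∘_ V (Comonad.T₁ M f) (α X)))
         (α-coalgebra : ∀ X → IsCoalgebra M (α X)) where
  open CartesianCategory V
  open Comonad M using (T₀)
  open Equiv

  coKleisliF-preservesFiniteProducts :
    PreservesFiniteProducts (CoKleisliCartesian V M) V (coKleisliF₀ M) (coKleisliF₁ M α)
  coKleisliF-preservesFiniteProducts = record
    { terminal = ≈id⇒isIso U (!-unique₂ V _ _)
    ; products = λ _ _ → ≈id⇒isIso U (⟨π₁,π₂⟩≈id V (coKleisliF-ε M α α-natural α-coalgebra π₁)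
                                                  (coKleisliF-ε M α α-natural α-coalgebra π₂))
    }

  α⊤-isIso : IsIso U (α ⊤)
  α⊤-isIso = point-of-terminal-isIso V (PreservesFiniteProducts.terminal T-preserves-products) (α ⊤)

  coKleisliF-isNormal :
    IsNormal (CoKleisliCartesian V M) V (coKleisliF₀ M) (coKleisliF₁ M α)
             coKleisliF-preservesFiniteProducts
  coKleisliF-isNormal = record
    { injective  = λ φf≈φg →
        ∘-isoʳ-cancel U α⊤-isIso (trans (sym identityʳ) (trans φf≈φg identityʳ))
    ; surjective = λ h →
        h ∘ IsIso.inv α⊤-isIso , trans identityʳ (∘-isoʳ-section U α⊤-isIso h)
    }

lemma4p19 : ∀ {o ℓ e} (V : CartesianCategory o ℓ e) → Closed V →
            (M : Comonad (CartesianCategory.U V)) →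
            PreservesFiniteProducts V V (Comonad.T₀ M) (Comonad.T₁ M) →
            (α : ∀ X → CartesianCategory._⇒_ V X (Comonad.T₀ M X)) →
            (∀ {X Y} (f : CartesianCategory._⇒_ V X Y) →
               CartesianCategory._≈_ V (CartesianCategory._∘_ V (α Y) f)
                                       (CartesianCategory._∘_ V (Comonad.T₁ M f) (α X))) →
            (∀ X → IsCoalgebra M (α X)) →
            IsFunctor (CoKleisli M) (CartesianCategory.U V)
                      (coKleisliF₀ M) (coKleisliF₁ M α)
            × Σ (PreservesFiniteProducts (CoKleisliCartesian V M) V
                   (coKleisliF₀ M) (coKleisliF₁ M α))
                (λ P → IsNormal (CoKleisliCartesian V M) V
                   (coKleisliF₀ M) (coKleisliF₁ M α) P)
lemma4p19 V _ M T-preserves-products α α-natural α-coalgebra =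
    coKleisliF-isFunctor M α α-natural α-coalgebra
  , coKleisliF-preservesFiniteProducts V M T-preserves-products α α-natural α-coalgebra
  , coKleisliF-isNormal V M T-preserves-products α α-natural α-coalgebra
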